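{- For every $\ell,k\in\mathbb{N}$ and every $\varepsilon>0$ there exists $N$ such that every $\varepsilon$-balanced red/blue edge-coloring of $K_n$ with $n>N$ contains pairwise disjoint vertex sets $A,B,S$ with $|A|=|B|=\ell$, $|S|=k$, all edges between $A$ and $S$ red and all edges between $B$ and $S$ blue. Moreover, for each fixed $\varepsilon$ there is a constant $C_\varepsilon$ (depending only on $\varepsilon$) such that one can take $N\le C_\varepsilon\, k\,(4\ell)^{2\ell}$.
   Context: A 2-edge-coloring of $K_n$ is $\varepsilon$-balanced if each color class contains at least $\varepsilon\binom n2$ edges. -}

module Defs where

open import Data.Bool using (Bool; true; false)
open import Data.Bool.Properties using () renaming (_≟_ to _≟ᴮ_)
open import Data.Nat using (ℕ; _<?_)
open import Data.Nat.Combinatorics using (_C_)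
open import Data.Fin using (Fin; toℕ)
open import Data.Fin.Subset using (Subset; _∈_; _∉_)
open import Data.List using (List; length; filter; cartesianProduct; allFin)
open import Data.Product using (_×_; _,_)
open import Relation.Nullary.Decidable using (_×-dec_)
open import Relation.Binary.PropositionalEquality using (_≡_)
open import Data.Rational using (ℚ; _≤_; _*_)
open import Data.Integer using (+_)
import Data.Rational as Q

-- A 2-edge-colouring of K_n: a symmetric function on pairs of vertices.
-- Colour true = red, false = blue. Values on the diagonal are irrelevant.
Colouring : ℕ → Set
Colouring n = Fin n → Fin n → Bool

Symmetric : ∀ {n} → Colouring n → Set
Symmetric c = ∀ i j → c i j ≡ c j i

edgeCount : ∀ {n} → Colouring n → Bool → ℕ
edgeCount {n} c b =
  length (filter (λ { (i , j) → (toℕ i <? toℕ j) ×-dec (c i j ≟ᴮ b) })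
                 (cartesianProduct (allFin n) (allFin n)))

ℕ→ℚ : ℕ → ℚ
ℕ→ℚ m = (+ m) Q./ 1

Balanced : ∀ {n} → ℚ → Colouring n → Set
Balanced {n} ε c =
  (ε * ℕ→ℚ (n C 2) ≤ ℕ→ℚ (edgeCount c true)) ×
  (ε * ℕ→ℚ (n C 2) ≤ ℕ→ℚ (edgeCount c false))

Disjoint : ∀ {n} → Subset n → Subset n → Set
Disjoint A B = ∀ i → i ∈ A → i ∉ B

AllColoured : ∀ {n} → Colouring n → Bool → Subset n → Subset n → Set
AllColoured c b X Y = ∀ i j → i ∈ X → j ∈ Y → c i j ≡ b

-- Let q be the denominator of ε, so each colour has at least C(n,2)/q edges, and
-- call a vertex rich in a colour when its degree in that colour is at least D = ⌊(n-1)/16q⌋.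
-- Double counting the blue edges between the red-poor vertices and the red-rich blue-poor
-- vertices shows that one of these two classes has at most 2D vertices, so in some colour
-- almost all rich vertices are mixed (rich in both colours); as that colour has many edges,
-- at least n/32q vertices are mixed. Starting from the mixed vertices, choose ℓ red centres one
-- at a time, keeping the common red neighbourhood: by averaging, some admissible centre keeps
-- a 1/32q fraction of the candidates. Then choose ℓ blue centres among the surviving candidates
-- in the same way. At least n/(32q)^(2ℓ+1) > k vertices survive, and any k of them form S.

module Submission where

open import Defs
open import Data.Bool using (Bool; true; false; not; _∧_; _∨_; T)
open import Data.Bool.Properties using (∨-identityʳ; ∨-zeroʳ; T-≡) renaming (_≟_ to _≟ᴮ_)
open import Data.Nat using (ℕ; zero; suc; _+_; _*_; _∸_; _^_; _≤_; _<_; _≥_; z≤n; s≤s; _≤?_; _<?_; _≤ᵇ_; NonZero; >-nonZero)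
open import Data.Nat using () renaming (_≤_ to _≤ℕ_)
open import Data.Nat.Properties hiding (_≟_)
open import Data.Nat.Combinatorics using (_C_; nCk+nC[k+1]≡[n+1]C[k+1]; nC1≡n)
open import Data.Nat.DivMod using (_/_; _%_; m/n*n≤m; m/n≤m; m%n<n; m≡m%n+[m/n]*n)
open import Data.Nat.Tactic.RingSolver using (solve-∀)
open import Data.Integer as ℤ using (+<+)
open import Data.Integer.Properties as ℤₚ using (pos-*; drop‿+≤+; +◃n≡+n)
open import Data.Rational using (ℚ; mkℚ; 0ℚ; *<*; toℚᵘ) renaming (_≤_ to _≤ℚ_; _<_ to _<ℚ_; _*_ to _*ℚ_)
open import Data.Rational.Properties using (toℚᵘ-homo-*; toℚᵘ-mono-≤; toℚᵘ-fromℚᵘ)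
open import Data.Rational.Unnormalised as ℚᵘ using (mkℚᵘ; *≤*)
open import Data.Rational.Unnormalised.Properties as ℚᵘₚ using ()
open import Data.Fin using (Fin; zero; suc; _≟_; toℕ)
open import Data.Fin.Subset using (∣_∣; _∈_)
open import Data.List using (List; _++_; length; filter; map; tabulate; allFin; cartesianProduct)
open import Data.List.Properties using (filter-++; length-++; map-tabulate)
open import Data.List.Extrema ≤-totalOrder using (argmax; argmax-all; f[xs]≤f[argmax])
open import Data.List.Relation.Unary.All using (lookup)
open import Data.List.Relation.Unary.All.Properties using (all-filter)
open import Data.List.Membership.Propositional.Properties using (∈-filter⁺; ∈-allFin)
import Data.Vec as Vec
open import Data.Vec.Properties using (lookup∘tabulate; []=⇒lookup)
open import Data.Empty using (⊥; ⊥-elim)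
open import Data.Product using (∃; ∃-syntax; _×_; _,_; proj₁; proj₂)
open import Data.Sum using (_⊎_; inj₁; inj₂)
open import Function using (id)
open import Function.Bundles using (Equivalence)
open import Relation.Unary using (Pred; Decidable)
open import Relation.Nullary using (yes; no; does; contradiction)
open import Relation.Nullary.Decidable using (dec-true; dec-false)
open import Relation.Binary.PropositionalEquality using (_≡_; refl; cong; cong₂; sym; trans; subst; subst₂; module ≡-Reasoning)
open import Algebra.Properties.Semiring.Sum +-*-semiring
  using (sum; sum-syntax; ∑-distrib-+; ∑-comm; *-distribˡ-sum; sum-cong-≗)

sum-mono-≤ : ∀ {m} {f g : Fin m → ℕ} → (∀ i → f i ≤ g i) → sum f ≤ sum g
sum-mono-≤ {zero}  f≤g = z≤n
sum-mono-≤ {suc m} f≤g = +-mono-≤ (f≤g zero) (sum-mono-≤ (λ i → f≤g (suc i)))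

sum-const : ∀ m k → ∑[ i < m ] k ≡ m * k
sum-const zero    k = refl
sum-const (suc m) k = cong (k +_) (sum-const m k)

𝟙 : Bool → ℕ
𝟙 true  = 1
𝟙 false = 0

count : ∀ {m} → (Fin m → Bool) → ℕ
count {m} P = ∑[ i < m ] 𝟙 (P i)

_⊆ᵇ_ : ∀ {m} → (Fin m → Bool) → (Fin m → Bool) → Set
P ⊆ᵇ Q = ∀ i → P i ≡ true → Q i ≡ true

insert : ∀ {m} → Fin m → (Fin m → Bool) → Fin m → Bool
insert v P u = P u ∨ does (u ≟ v)

count≤size : ∀ {m} (P : Fin m → Bool) → count P ≤ m
count≤size {zero}  P = z≤n
count≤size {suc m} P with P zero
... | true  = s≤s (count≤size (λ i → P (suc i)))
... | false = m≤n⇒m≤1+n (count≤size (λ i → P (suc i)))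

count-mono : ∀ {m} {P Q : Fin m → Bool} → P ⊆ᵇ Q → count P ≤ count Q
count-mono {P = P} {Q} P⊆Q = sum-mono-≤ pointwise
  where
  pointwise : ∀ i → 𝟙 (P i) ≤ 𝟙 (Q i)
  pointwise i with P i | Q i | P⊆Q i
  ... | false | _     | _    = z≤n
  ... | true  | true  | _    = ≤-refl
  ... | true  | false | P⊆Qi with () ← P⊆Qi refl

count-empty : ∀ {m} → count {m} (λ _ → false) ≡ 0
count-empty {zero}  = refl
count-empty {suc m} = count-empty {m}

count-insert : ∀ {m} v (P : Fin m → Bool) → P v ≡ false → count (insert v P) ≡ suc (count P)
count-insert {suc m} zero P Pv≡false rewrite Pv≡false =
  cong suc (sum-cong-≗ (λ i → cong 𝟙 (∨-identityʳ (P (suc i)))))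
count-insert {suc m} (suc v) P Pv≡false =
  trans (cong₂ _+_ (cong 𝟙 (∨-identityʳ (P zero))) (count-insert v (λ i → P (suc i)) Pv≡false))
        (+-suc (𝟙 (P zero)) (count (λ i → P (suc i))))

count<size⇒∃false : ∀ {m} (P : Fin m → Bool) → count P < m → ∃ λ i → P i ≡ false
count<size⇒∃false {suc m} P lt with P zero in eq
... | false = zero , eq
... | true  with count<size⇒∃false (λ i → P (suc i)) (≤-pred lt)
...   | i , Pi = suc i , Pi

subset-of-size : ∀ {m} (T : Fin m → Bool) k → k ≤ count T → ∃ λ S → S ⊆ᵇ T × count S ≡ k
subset-of-size {m}     T zero    _  = (λ _ → false) , (λ _ ()) , count-empty {m}
subset-of-size {suc m} T (suc k) k<T with T zero in eq
... | true  with subset-of-size (λ i → T (suc i)) k (≤-pred k<T)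
...   | S , S⊆T , |S| = (λ { zero → true ; (suc i) → S i }) , (λ { zero _ → eq ; (suc i) → S⊆T i }) , cong suc |S|
subset-of-size {suc m} T (suc k) k<T | false with subset-of-size (λ i → T (suc i)) (suc k) k<T
...   | S , S⊆T , |S| = (λ { zero → false ; (suc i) → S i }) , (λ { zero () ; (suc i) → S⊆T i }) , |S|

maximiser : ∀ {m} (P : Fin m → Bool) (g : Fin m → ℕ) v₀ → P v₀ ≡ true →
  ∃ λ v → P v ≡ true × (∀ u → P u ≡ true → g u ≤ g v)
maximiser {m} P g v₀ Pv₀ =
  v , argmax-all g Pv₀ (all-filter P? (allFin _)) ,
  λ u Pu → lookup (f[xs]≤f[argmax] v₀ candidates) (∈-filter⁺ P? (∈-allFin u) Pu)
  where
  P? : Decidable (λ u → P u ≡ true)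
  P? u = P u ≟ᴮ true
  candidates : List (Fin m)
  candidates = filter P? (allFin m)
  v : Fin m
  v = argmax g v₀ candidates

averaging : ∀ {m} (P : Fin m → Bool) (g : Fin m → ℕ) v₀ → P v₀ ≡ true →
  ∃ λ v → P v ≡ true × ∑[ u < m ] (𝟙 (P u) * g u) ≤ m * g v
averaging {m} P g v₀ Pv₀ with maximiser P g v₀ Pv₀
... | v , Pv , max = v , Pv , ≤-trans (sum-mono-≤ pointwise) (≤-reflexive (sum-const m (g v)))
  where
  pointwise : ∀ u → 𝟙 (P u) * g u ≤ g v
  pointwise u with P u in Pu
  ... | true  = ≤-trans (≤-reflexive (+-identityʳ (g u))) (max u Pu)
  ... | false = z≤n

insert-self : ∀ {m} v (P : Fin m → Bool) → insert v P v ≡ true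
insert-self v P rewrite dec-true (v ≟ v) refl = ∨-zeroʳ (P v)

insert-cases : ∀ {m} {v u} (P : Fin m → Bool) → insert v P u ≡ true → P u ≡ true ⊎ u ≡ v
insert-cases {v = v} {u} P Pu∨u≡v with P u | u ≟ v
... | true  | _       = inj₁ refl
... | false | yes u≡v = inj₂ u≡v

insert-false : ∀ {m} {v u} (P : Fin m → Bool) → insert v P u ≡ false → P u ≡ false
insert-false {u = u} P Pu∨u≡v with P u
... | false = refl

count-cover : ∀ {m} {P Q R : Fin m → Bool} → P ⊆ᵇ (λ i → Q i ∨ R i) → count P ≤ count Q + count R
count-cover {m} {P} {Q} {R} P⊆Q∪R =
  ≤-trans (sum-mono-≤ pointwise) (≤-reflexive (∑-distrib-+ (λ i → 𝟙 (Q i)) (λ i → 𝟙 (R i))))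
  where
  pointwise : ∀ i → 𝟙 (P i) ≤ 𝟙 (Q i) + 𝟙 (R i)
  pointwise i with P i | Q i | R i | P⊆Q∪R i
  ... | false | _     | _     | _ = z≤n
  ... | true  | true  | _     | _ = s≤s z≤n
  ... | true  | false | true  | _ = s≤s z≤n
  ... | true  | false | false | P⊆Q∪Rᵢ with () ← P⊆Q∪Rᵢ refl

∧-trueˡ : ∀ {x y} → x ∧ y ≡ true → x ≡ true
∧-trueˡ {true} _ = refl

∧-trueʳ : ∀ {x y} → x ∧ y ≡ true → y ≡ true
∧-trueʳ {true} xy = xy

𝟙-*-∧-swap : ∀ x y z → 𝟙 x * 𝟙 (y ∧ z) ≡ 𝟙 y * 𝟙 (x ∧ z)
𝟙-*-∧-swap true  true  z = refl
𝟙-*-∧-swap true  false z = refl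
𝟙-*-∧-swap false true  z = refl
𝟙-*-∧-swap false false z = refl

double-count : ∀ {m} (R : Fin m → Fin m → Bool) → (∀ u v → R u v ≡ R v u) → (U T : Fin m → Bool) →
  ∑[ u < m ] (𝟙 (U u) * count (λ t → T t ∧ R u t)) ≡ ∑[ t < m ] (𝟙 (T t) * count (λ u → U u ∧ R t u))
double-count {m} R R-sym U T = begin
  ∑[ u < m ] (𝟙 (U u) * count (λ t → T t ∧ R u t))
    ≡⟨ sum-cong-≗ (λ u → *-distribˡ-sum (𝟙 (U u)) (λ t → 𝟙 (T t ∧ R u t))) ⟩
  ∑[ u < m ] ∑[ t < m ] (𝟙 (U u) * 𝟙 (T t ∧ R u t))
    ≡⟨ sum-cong-≗ (λ u → sum-cong-≗ (λ t → trans (cong (λ r → 𝟙 (U u) * 𝟙 (T t ∧ r)) (R-sym u t))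
                                                  (𝟙-*-∧-swap (U u) (T t) (R t u)))) ⟩
  ∑[ u < m ] ∑[ t < m ] (𝟙 (T t) * 𝟙 (U u ∧ R t u))
    ≡⟨ ∑-comm (λ u t → 𝟙 (T t) * 𝟙 (U u ∧ R t u)) ⟩
  ∑[ t < m ] ∑[ u < m ] (𝟙 (T t) * 𝟙 (U u ∧ R t u))
    ≡⟨ sum-cong-≗ (λ t → *-distribˡ-sum (𝟙 (T t)) (λ u → 𝟙 (U u ∧ R t u))) ⟨
  ∑[ t < m ] (𝟙 (T t) * count (λ u → U u ∧ R t u)) ∎
  where
    open ≡-Reasoning

count-tabulate-filter : ∀ {ℓ} {A : Set} {P : Pred A ℓ} (P? : Decidable P) {m} (h : Fin m → A) →
  length (filter P? (tabulate h)) ≡ count (λ i → does (P? (h i)))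
count-tabulate-filter P? {zero}  h = refl
count-tabulate-filter P? {suc m} h with does (P? (h zero))
... | true  = cong suc (count-tabulate-filter P? (λ i → h (suc i)))
... | false = count-tabulate-filter P? (λ i → h (suc i))

count-cartesianProduct-filter : ∀ {ℓ} {A B : Set} {P : Pred (A × B) ℓ} (P? : Decidable P) {m p}
  (f : Fin m → A) (g : Fin p → B) →
  length (filter P? (cartesianProduct (tabulate f) (tabulate g))) ≡
  ∑[ i < m ] count (λ j → does (P? (f i , g j)))
count-cartesianProduct-filter P? {zero}  f g = refl
count-cartesianProduct-filter {A = A} {B} P? {suc m} f g = begin
  length (filter P? (row ++ rest))
    ≡⟨ cong length (filter-++ P? row rest) ⟩
  length (filter P? row ++ filter P? rest)
    ≡⟨ length-++ (filter P? row) ⟩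
  length (filter P? row) + length (filter P? rest)
    ≡⟨ cong₂ _+_ (trans (cong (λ xs → length (filter P? xs)) (map-tabulate g (f zero ,_)))
                       (count-tabulate-filter P? (λ j → f zero , g j)))
                 (count-cartesianProduct-filter P? (λ i → f (suc i)) g) ⟩
  ∑[ i < suc m ] count (λ j → does (P? (f i , g j))) ∎
  where
  open ≡-Reasoning
  row rest : List (A × B)
  row = map (f zero ,_) (tabulate g)
  rest = cartesianProduct (tabulate (λ i → f (suc i))) (tabulate g)

2*[nC2]≡n*[n∸1] : ∀ n → 2 * (n C 2) ≡ n * (n ∸ 1)
2*[nC2]≡n*[n∸1] zero          = refl
2*[nC2]≡n*[n∸1] (suc zero)    = refl
2*[nC2]≡n*[n∸1] (suc (suc m)) = begin
  2 * (suc (suc m) C 2)          ≡⟨ cong (2 *_) (nCk+nC[k+1]≡[n+1]C[k+1] (suc m) 1) ⟨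
  2 * (suc m C 1 + suc m C 2)    ≡⟨ cong (λ x → 2 * (x + suc m C 2)) (nC1≡n (suc m)) ⟩
  2 * (suc m + suc m C 2)        ≡⟨ *-distribˡ-+ 2 (suc m) (suc m C 2) ⟩
  2 * suc m + 2 * (suc m C 2)    ≡⟨ cong (2 * suc m +_) (2*[nC2]≡n*[n∸1] (suc m)) ⟩
  2 * suc m + suc m * m          ≡⟨ ring m ⟩
  suc (suc m) * suc m            ∎
  where
  open ≡-Reasoning
  ring : ∀ m → 2 * suc m + suc m * m ≡ suc (suc m) * suc m
  ring = solve-∀

cancel-scale : ∀ {a d x e W} n .{{_ : NonZero n}} → a * d ≤ n * x → n ≤ W * e → e ≤ d → a ≤ W * x
cancel-scale {a} {d} {x} {e} {W} n ad≤nx n≤We e≤d = *-cancelˡ-≤ n (begin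
  n * a        ≤⟨ *-monoˡ-≤ a n≤We ⟩
  W * e * a    ≡⟨ ring₁ W e a ⟩
  W * (a * e)  ≤⟨ *-monoʳ-≤ W (*-monoʳ-≤ a e≤d) ⟩
  W * (a * d)  ≤⟨ *-monoʳ-≤ W ad≤nx ⟩
  W * (n * x)  ≡⟨ ring₂ W n x ⟩
  n * (W * x)  ∎)
  where
  open ≤-Reasoning
  ring₁ : ∀ W e a → W * e * a ≡ W * (a * e)
  ring₁ = solve-∀
  ring₂ : ∀ W n x → W * (n * x) ≡ n * (W * x)
  ring₂ = solve-∀

[y∸D]*x≤D*y⇒x≤2D⊎y≤2D : ∀ x y D → (y ∸ D) * x ≤ D * y → x ≤ D + D ⊎ y ≤ D + D
[y∸D]*x≤D*y⇒x≤2D⊎y≤2D x y D h with x ≤? D + D | y ≤? D + D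
... | yes x≤2D | _        = inj₁ x≤2D
... | no _     | yes y≤2D = inj₂ y≤2D
... | no x≰2D  | no y≰2D  = contradiction h (<⇒≱ D*y<[y∸D]*x)
  where
  z : ℕ
  z = y ∸ D
  y≡D+z : y ≡ D + z
  y≡D+z = sym (m+[n∸m]≡n (≤-trans (m≤m+n D D) (<⇒≤ (≰⇒> y≰2D))))
  D<z : D < z
  D<z = ≤-trans (≤-reflexive (sym (m+n∸m≡n D (suc D)))) (∸-monoˡ-≤ D (≤-trans (≤-reflexive (+-suc D D)) (≰⇒> y≰2D)))
  D*D<z*[1+D] : D * D < z * suc D
  D*D<z*[1+D] = <-≤-trans (*-mono-< (n<1+n D) (n<1+n D)) (*-monoˡ-≤ (suc D) D<z)
  open ≤-Reasoning
  D*y<[y∸D]*x : D * y < z * x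
  D*y<[y∸D]*x = begin-strict
    D * y                 ≡⟨ cong (D *_) y≡D+z ⟩
    D * (D + z)           ≡⟨ ring₁ z D ⟩
    z * D + D * D         <⟨ +-monoʳ-< (z * D) D*D<z*[1+D] ⟩
    z * D + z * suc D     ≡⟨ ring₂ z D ⟩
    z * suc (D + D)       ≤⟨ *-monoʳ-≤ z (≰⇒> x≰2D) ⟩
    z * x                 ∎
    where
    ring₁ : ∀ z D → D * (D + z) ≡ z * D + D * D
    ring₁ = solve-∀
    ring₂ : ∀ z D → z * D + z * suc D ≡ z * suc (D + D)
    ring₂ = solve-∀

1+m≤d*[1+m/d] : ∀ m d .{{_ : NonZero d}} → suc m ≤ d * suc (m / d)
1+m≤d*[1+m/d] m d = begin
  suc m                    ≡⟨ cong suc (m≡m%n+[m/n]*n m d) ⟩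
  suc (m % d + m / d * d)  ≤⟨ +-monoˡ-≤ (m / d * d) (m%n<n m d) ⟩
  d + m / d * d            ≡⟨ cong (d +_) (*-comm (m / d) d) ⟩
  d + d * (m / d)          ≡⟨ *-suc d (m / d) ⟨
  d * suc (m / d)          ∎
  where
    open ≤-Reasoning

d*[m/d]≤m : ∀ m d .{{_ : NonZero d}} → d * (m / d) ≤ m
d*[m/d]≤m m d = ≤-trans (≤-reflexive (*-comm d (m / d))) (m/n*n≤m m d)

1+m≤32qM : ∀ m q D M → 16 * q * D ≤ m → m ≤ 2 * q * (D + D + D + M) → 1 ≤ m → suc m ≤ 32 * q * M
1+m≤32qM m q D M 16qD≤m m≤2q[3D+M] 1≤m = begin
  suc m            ≡⟨ +-comm 1 m ⟩
  m + 1            ≤⟨ +-monoʳ-≤ m 1≤m ⟩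
  m + m            ≤⟨ m≤m+n (m + m) (8 * m) ⟩
  m + m + 8 * m    ≡⟨ ring₁ m ⟩
  10 * m           ≤⟨ +-cancelˡ-≤ (6 * m) (10 * m) (32 * q * M) 6m+10m≤6m+32qM ⟩
  32 * q * M       ∎
  where
  open ≤-Reasoning
  ring₁ : ∀ m → m + m + 8 * m ≡ 10 * m
  ring₁ = solve-∀
  ring₂ : ∀ q D M → 16 * (2 * q * (D + D + D + M)) ≡ 6 * (16 * q * D) + 32 * q * M
  ring₂ = solve-∀
  6m+10m≤6m+32qM : 6 * m + 10 * m ≤ 6 * m + 32 * q * M
  6m+10m≤6m+32qM = begin
    6 * m + 10 * m                   ≡⟨ *-distribʳ-+ m 6 10 ⟨
    16 * m                           ≤⟨ *-monoʳ-≤ 16 m≤2q[3D+M] ⟩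
    16 * (2 * q * (D + D + D + M))   ≡⟨ ring₂ q D M ⟩
    6 * (16 * q * D) + 32 * q * M    ≤⟨ +-monoˡ-≤ (32 * q * M) (*-monoʳ-≤ 6 16qD≤m) ⟩
    6 * m + 32 * q * M               ∎

threshold-gap : ∀ n q l D → 1 ≤ l → n ≤ 16 * q * suc D → 96 * q * l < n →
  l + l ≤ D × n ≤ 32 * q * (D ∸ (l + l))
threshold-gap n q l D 1≤l n≤16q[1+D] 96ql<n with l + l ≤? D
... | no 2l≰D = contradiction (≤-trans n≤16q[1+D] 16q[1+D]≤96ql) (<⇒≱ 96ql<n)
  where
  ring : ∀ q l → 16 * q * (l + l) + 64 * q * l ≡ 96 * q * l
  ring = solve-∀
  16q[1+D]≤96ql : 16 * q * suc D ≤ 96 * q * l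
  16q[1+D]≤96ql = ≤-trans (*-monoʳ-≤ (16 * q) (≰⇒> 2l≰D)) (≤-trans (m≤m+n _ (64 * q * l)) (≤-reflexive (ring q l)))
... | yes 2l≤D = 2l≤D , +-cancelʳ-≤ n n (32 * q * E) 2n≤32qE+n
  where
  E : ℕ
  E = D ∸ (l + l)
  open ≤-Reasoning
  ring₁ : ∀ q E l → 2 * (16 * q * suc (E + (l + l))) ≡ 32 * q * E + 64 * q * l + 32 * q
  ring₁ = solve-∀
  ring₂ : ∀ q E l → 32 * q * E + 64 * q * l + 32 * q * l ≡ 32 * q * E + 96 * q * l
  ring₂ = solve-∀
  n≤16q[1+E+2l] : n ≤ 16 * q * suc (E + (l + l))
  n≤16q[1+E+2l] = ≤-trans n≤16q[1+D] (≤-reflexive (cong (λ x → 16 * q * suc x) (sym (m∸n+n≡m 2l≤D))))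
  32q≤32ql : 32 * q ≤ 32 * q * l
  32q≤32ql = ≤-trans (≤-reflexive (sym (*-identityʳ (32 * q)))) (*-monoʳ-≤ (32 * q) 1≤l)
  2n≤32qE+n : n + n ≤ 32 * q * E + n
  2n≤32qE+n = begin
    n + n                                      ≡⟨ cong (n +_) (+-identityʳ n) ⟨
    2 * n                                      ≤⟨ *-monoʳ-≤ 2 n≤16q[1+E+2l] ⟩
    2 * (16 * q * suc (E + (l + l)))           ≡⟨ ring₁ q E l ⟩
    32 * q * E + 64 * q * l + 32 * q           ≤⟨ +-monoʳ-≤ (32 * q * E + 64 * q * l) 32q≤32ql ⟩
    32 * q * E + 64 * q * l + 32 * q * l       ≡⟨ ring₂ q E l ⟩
    32 * q * E + 96 * q * l                    ≤⟨ +-monoʳ-≤ (32 * q * E) (<⇒≤ 96ql<n) ⟩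
    32 * q * E + n                             ∎

m^k≤m^j*n^k : ∀ m n j k .{{_ : NonZero m}} .{{_ : NonZero n}} → m ≤ n ⊎ k ≤ j → m ^ k ≤ m ^ j * n ^ k
m^k≤m^j*n^k m n j k (inj₁ m≤n) = ≤-trans (^-monoˡ-≤ k m≤n) (m≤n*m (n ^ k) (m ^ j) {{m^n≢0 m j}})
m^k≤m^j*n^k m n j k (inj₂ k≤j) = ≤-trans (^-monoʳ-≤ m k≤j) (m≤m*n (m ^ j) (n ^ k) {{m^n≢0 n k}})

[32q]^[ℓ+ℓ]≤[32q]^16q*[4ℓ]^[ℓ+ℓ] : ∀ q ℓ → 1 ≤ q → 1 ≤ ℓ →
  (32 * q) ^ (ℓ + ℓ) ≤ (32 * q) ^ (16 * q) * (4 * ℓ) ^ (ℓ + ℓ)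
[32q]^[ℓ+ℓ]≤[32q]^16q*[4ℓ]^[ℓ+ℓ] q ℓ 1≤q 1≤ℓ =
  m^k≤m^j*n^k (32 * q) (4 * ℓ) (16 * q) (ℓ + ℓ) small-base-or-exponent
  where
  instance
    32q≢0 : NonZero (32 * q)
    32q≢0 = m*n≢0 32 q {{_}} {{>-nonZero 1≤q}}
    4ℓ≢0 : NonZero (4 * ℓ)
    4ℓ≢0 = m*n≢0 4 ℓ {{_}} {{>-nonZero 1≤ℓ}}
  small-base-or-exponent : 32 * q ≤ 4 * ℓ ⊎ ℓ + ℓ ≤ 16 * q
  small-base-or-exponent with 8 * q ≤? ℓ
  ... | yes 8q≤ℓ = inj₁ (≤-trans (≤-reflexive (*-assoc 4 8 q)) (*-monoʳ-≤ 4 8q≤ℓ))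
  ... | no 8q≰ℓ  = inj₂ (≤-trans (+-mono-≤ ℓ≤8q ℓ≤8q) (≤-reflexive (ring q)))
    where
    ℓ≤8q : ℓ ≤ 8 * q
    ℓ≤8q = <⇒≤ (≰⇒> 8q≰ℓ)
    ring : ∀ q → 8 * q + 8 * q ≡ 16 * q
    ring = solve-∀

size-bounds : ∀ q ℓ k → 1 ≤ q → 1 ≤ ℓ → 1 ≤ k →
  let N = 96 * q * (32 * q) ^ (16 * q) * k * (4 * ℓ) ^ (2 * ℓ) in
  96 * q * ℓ ≤ N × (32 * q) ^ suc (ℓ + ℓ) * k ≤ N
size-bounds q ℓ k 1≤q 1≤ℓ 1≤k = *-mono-≤ 96q≤96qZk ℓ≤P , W^[1+2ℓ]k≤N
  where
  W Z P : ℕ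
  W = 32 * q
  Z = W ^ (16 * q)
  P = (4 * ℓ) ^ (2 * ℓ)
  instance
    W≢0 : NonZero W
    W≢0 = m*n≢0 32 q {{_}} {{>-nonZero 1≤q}}
    k≢0 : NonZero k
    k≢0 = >-nonZero 1≤k
    Z≢0 : NonZero Z
    Z≢0 = m^n≢0 W (16 * q)
  P≡[4ℓ]^[ℓ+ℓ] : P ≡ (4 * ℓ) ^ (ℓ + ℓ)
  P≡[4ℓ]^[ℓ+ℓ] = cong (λ e → (4 * ℓ) ^ (ℓ + e)) (+-identityʳ ℓ)
  96q≤96qZk : 96 * q ≤ 96 * q * Z * k
  96q≤96qZk = ≤-trans (m≤m*n (96 * q) Z) (m≤m*n (96 * q * Z) k)
  ℓ≤P : ℓ ≤ P
  ℓ≤P = ≤-trans (m≤n*m ℓ 4) (≤-trans (≤-reflexive (sym (*-identityʳ (4 * ℓ))))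
          (^-monoʳ-≤ (4 * ℓ) {{m*n≢0 4 ℓ {{_}} {{>-nonZero 1≤ℓ}}}} (≤-trans 1≤ℓ (m≤m+n ℓ _))))
  open ≤-Reasoning
  ring : ∀ W Z P k q → W * (Z * P) * k + 64 * q * (Z * P) * k ≡ (W + 64 * q) * Z * k * P
  ring = solve-∀
  W^[1+2ℓ]k≤N : W ^ suc (ℓ + ℓ) * k ≤ 96 * q * Z * k * P
  W^[1+2ℓ]k≤N = begin
    W * W ^ (ℓ + ℓ) * k
      ≤⟨ *-monoˡ-≤ k (*-monoʳ-≤ W ([32q]^[ℓ+ℓ]≤[32q]^16q*[4ℓ]^[ℓ+ℓ] q ℓ 1≤q 1≤ℓ)) ⟩
    W * (Z * (4 * ℓ) ^ (ℓ + ℓ)) * k         ≡⟨ cong (λ x → W * (Z * x) * k) P≡[4ℓ]^[ℓ+ℓ] ⟨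
    W * (Z * P) * k                         ≤⟨ m≤m+n _ (64 * q * (Z * P) * k) ⟩
    W * (Z * P) * k + 64 * q * (Z * P) * k  ≡⟨ ring W Z P k q ⟩
    (W + 64 * q) * Z * k * P                ≡⟨ cong (λ x → x * Z * k * P) (ring₂ q) ⟩
    96 * q * Z * k * P                      ∎
    where
    ring₂ : ∀ q → 32 * q + 64 * q ≡ 96 * q
    ring₂ = solve-∀

toℚᵘ-ℕ→ℚ : ∀ m → toℚᵘ (ℕ→ℚ m) ℚᵘ.≃ mkℚᵘ (ℤ.+ m) 0
toℚᵘ-ℕ→ℚ m = toℚᵘ-fromℚᵘ (mkℚᵘ (ℤ.+ m) 0)

toℚᵘ-*-ℕ→ℚ : ∀ ε m → toℚᵘ (ε *ℚ ℕ→ℚ m) ℚᵘ.≃ toℚᵘ ε ℚᵘ.* mkℚᵘ (ℤ.+ m) 0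
toℚᵘ-*-ℕ→ℚ ε m = ℚᵘₚ.≃-trans (toℚᵘ-homo-* ε (ℕ→ℚ m)) (ℚᵘₚ.*-congˡ {toℚᵘ ε} (toℚᵘ-ℕ→ℚ m))

positive-scale-bound : (ε : ℚ) → 0ℚ <ℚ ε →
  ∃ λ q → 1 ≤ q × (∀ m e → ε *ℚ ℕ→ℚ m ≤ℚ ℕ→ℚ e → m ≤ q * e)
positive-scale-bound (mkℚ (ℤ.+ zero) d _) (*<* (+<+ ()))
positive-scale-bound ε@(mkℚ (ℤ.+ suc p) d _) _ = suc d , s≤s z≤n , bound
  where
  bound : ∀ m e → ε *ℚ ℕ→ℚ m ≤ℚ ℕ→ℚ e → m ≤ suc d * e
  bound m e εm≤e
    with ℚᵘₚ.≤-respʳ-≃ (toℚᵘ-ℕ→ℚ e) (ℚᵘₚ.≤-respˡ-≃ (toℚᵘ-*-ℕ→ℚ ε m) (toℚᵘ-mono-≤ εm≤e))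
  ... | *≤* εm≤e = begin
    m               ≤⟨ m≤m+n m (p * m) ⟩
    m + p * m       ≤⟨ drop‿+≤+ (subst₂ ℤ._≤_ (trans (ℤₚ.*-identityʳ _) (+◃n≡+n _)) (sym (pos-* e _)) εm≤e) ⟩
    e * suc (d * 1) ≡⟨ cong (λ x → e * suc x) (*-identityʳ d) ⟩
    e * suc d       ≡⟨ *-comm e (suc d) ⟩
    suc d * e       ∎
    where
      open ≤-Reasoning

module Neighbourhood {n : ℕ} (c : Colouring n) where

  -- The diagonal c v v is junk, so a vertex is never its own neighbour.
  neighbour : Bool → Fin n → Fin n → Bool
  neighbour b v t = not (does (v ≟ t)) ∧ does (c v t ≟ᴮ b)

  degree : Bool → Fin n → ℕ
  degree b v = count (neighbour b v)

  degreeIn : Bool → (Fin n → Bool) → Fin n → ℕ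
  degreeIn b T v = count (λ t → T t ∧ neighbour b v t)

  neighbour-irrefl : ∀ b v → neighbour b v v ≡ false
  neighbour-irrefl b v rewrite dec-true (v ≟ v) refl = refl

  neighbour-sym : Symmetric c → ∀ b v t → neighbour b v t ≡ neighbour b t v
  neighbour-sym c-sym b v t rewrite c-sym v t with v ≟ t | t ≟ v
  ... | yes _   | yes _   = refl
  ... | no _    | no _    = refl
  ... | yes v≡t | no t≢v  = ⊥-elim (t≢v (sym v≡t))
  ... | no v≢t  | yes t≡v = ⊥-elim (v≢t (sym t≡v))

  neighbour⇒colour : ∀ b v t → neighbour b v t ≡ true → c v t ≡ b
  neighbour⇒colour b v t adj with v ≟ t | c v t ≟ᴮ b
  neighbour⇒colour b v t adj | no _  | yes cvt≡b = cvt≡b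
  neighbour⇒colour b v t () | no _  | no _
  neighbour⇒colour b v t () | yes _ | _

  edgeCount≤degree-sum : ∀ b → edgeCount c b ≤ ∑[ v < n ] degree b v
  edgeCount≤degree-sum b =
    ≤-trans (≤-reflexive (count-cartesianProduct-filter _ {n} {n} id id))
            (sum-mono-≤ (λ i → count-mono (edge⇒neighbour i)))
    where
    edge⇒neighbour : ∀ i j → does (toℕ i <? toℕ j) ∧ does (c i j ≟ᴮ b) ≡ true → neighbour b i j ≡ true
    edge⇒neighbour i j edge with i ≟ j
    ... | no _     = ∧-trueʳ edge
    ... | yes refl with () ← trans (sym edge) (cong (_∧ does (c i i ≟ᴮ b)) (dec-false (toℕ i <? toℕ i) (n≮n _)))

  balanced⇒degree-sum : ∀ q b → n C 2 ≤ q * edgeCount c b → n * (n ∸ 1) ≤ 2 * q * ∑[ v < n ] degree b v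
  balanced⇒degree-sum q b balanced = begin
    n * (n ∸ 1)                       ≡⟨ 2*[nC2]≡n*[n∸1] n ⟨
    2 * (n C 2)                       ≤⟨ *-monoʳ-≤ 2 balanced ⟩
    2 * (q * edgeCount c b)           ≤⟨ *-monoʳ-≤ 2 (*-monoʳ-≤ q (edgeCount≤degree-sum b)) ⟩
    2 * (q * ∑[ v < n ] degree b v)   ≡⟨ *-assoc 2 q _ ⟨
    2 * q * ∑[ v < n ] degree b v     ∎
    where
    open ≤-Reasoning

  degreeIn-sum≤ : ∀ b (T F : Fin n → Bool) → ∑[ v < n ] (𝟙 (F v) * degreeIn b T v) ≤ count T * count F
  degreeIn-sum≤ b T F =
    ≤-trans (sum-mono-≤ pointwise) (≤-reflexive (sym (*-distribˡ-sum (count T) (λ v → 𝟙 (F v)))))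
    where
    pointwise : ∀ v → 𝟙 (F v) * degreeIn b T v ≤ count T * 𝟙 (F v)
    pointwise v with F v
    ... | true  = ≤-trans (≤-reflexive (+-identityʳ _))
                    (≤-trans (count-mono (λ t → ∧-trueˡ {T t})) (≤-reflexive (sym (*-identityʳ _))))
    ... | false = z≤n

  count≤degreeIn+degree : ∀ (Y : Fin n → Bool) u → Y u ≡ false → count Y ≤ degreeIn false Y u + degree true u
  count≤degreeIn+degree Y u Yu =
    ≤-trans (sum-mono-≤ pointwise)
            (≤-reflexive (∑-distrib-+ (λ t → 𝟙 (Y t ∧ neighbour false u t)) (λ t → 𝟙 (neighbour true u t))))
    where
    pointwise : ∀ t → 𝟙 (Y t) ≤ 𝟙 (Y t ∧ neighbour false u t) + 𝟙 (neighbour true u t)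
    pointwise t with Y t in Yt | u ≟ t
    ... | false | _        = z≤n
    ... | true  | yes refl with () ← trans (sym Yu) Yt
    ... | true  | no _     with c u t
    ...   | true  = s≤s z≤n
    ...   | false = s≤s z≤n

  record Biclique (b : Bool) (W s : ℕ) (T F : Fin n → Bool) : Set where
    field
      centres leaves  : Fin n → Bool
      leaves⊆T        : leaves ⊆ᵇ T
      centres-avoid-F : ∀ a → centres a ≡ true → F a ≡ false
      count-centres   : count centres ≡ s
      complete        : ∀ a t → centres a ≡ true → leaves t ≡ true → neighbour b a t ≡ true
      leaves-large    : count T ≤ W ^ s * count leaves

  empty-biclique : ∀ {b W} T F → Biclique b W 0 T F
  empty-biclique T F = record
    { centres = λ _ → false ; leaves = T ; leaves⊆T = λ _ Tt → Tt ; centres-avoid-F = λ _ ()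
    ; count-centres = count-empty {n} ; complete = λ _ _ () ; leaves-large = ≤-reflexive (sym (+-identityʳ _)) }

  biclique-extend : ∀ {b W s T F} v → F v ≡ false → count T ≤ W * degreeIn b T v →
    Biclique b W s (λ t → T t ∧ neighbour b v t) (insert v F) → Biclique b W (suc s) T F
  biclique-extend {b} {W} {s} {T} {F} v Fv large K = record
    { centres = insert v centres
    ; leaves = leaves
    ; leaves⊆T = λ t lt → ∧-trueˡ (leaves⊆T t lt)
    ; centres-avoid-F = avoid
    ; count-centres = trans (count-insert v centres v∉centres) (cong suc count-centres)
    ; complete = adjacent
    ; leaves-large = begin
        count T                          ≤⟨ large ⟩
        W * degreeIn b T v               ≤⟨ *-monoʳ-≤ W leaves-large ⟩
        W * (W ^ s * count leaves)       ≡⟨ *-assoc W (W ^ s) (count leaves) ⟨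
        W ^ suc s * count leaves         ∎
    }
    where
    open Biclique K
    open ≤-Reasoning
    v∉centres : centres v ≡ false
    v∉centres with centres v in cv
    ... | false = refl
    ... | true  with () ← trans (sym (insert-self v F)) (centres-avoid-F v cv)
    avoid : ∀ a → insert v centres a ≡ true → F a ≡ false
    avoid a a∈ with insert-cases centres a∈
    ... | inj₁ ca   = insert-false F (centres-avoid-F a ca)
    ... | inj₂ refl = Fv
    adjacent : ∀ a t → insert v centres a ≡ true → leaves t ≡ true → neighbour b a t ≡ true
    adjacent a t a∈ lt with insert-cases centres a∈
    ... | inj₁ ca   = complete a t ca lt
    ... | inj₂ refl = ∧-trueʳ {T t} (leaves⊆T t lt)

module Greedy {n} {c : Colouring n} (c-sym : Symmetric c) (b : Bool) {D W E : ℕ} (n≤W*E : n ≤ W * E) where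

  open Neighbourhood c

  MinDegree : (Fin n → Bool) → Set
  MinDegree T = ∀ t → T t ≡ true → D ≤ degree b t

  count*D≤degree-sum : ∀ T → MinDegree T → count T * D ≤ ∑[ t < n ] (𝟙 (T t) * degree b t)
  count*D≤degree-sum T T-deg =
    ≤-trans (≤-reflexive (trans (*-comm (count T) D) (*-distribˡ-sum D (λ t → 𝟙 (T t)))))
            (sum-mono-≤ pointwise)
    where
    pointwise : ∀ t → D * 𝟙 (T t) ≤ 𝟙 (T t) * degree b t
    pointwise t with T t in Tt
    ... | true  = ≤-trans (≤-reflexive (*-identityʳ D)) (≤-trans (T-deg t Tt) (≤-reflexive (sym (+-identityʳ _))))
    ... | false = ≤-reflexive (*-zeroʳ D)

  edges-leaving-F : ∀ (T F : Fin n → Bool) j → MinDegree T → count F ≤ j →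
    count T * (D ∸ j) ≤ ∑[ v < n ] (𝟙 (not (F v)) * degreeIn b T v)
  edges-leaving-F T F j T-deg |F|≤j = begin
    count T * (D ∸ j)                   ≡⟨ *-distribˡ-∸ (count T) D j ⟩
    count T * D ∸ count T * j           ≤⟨ ∸-monoˡ-≤ (count T * j) total ⟩
    count T * j + leaving ∸ count T * j ≡⟨ m+n∸m≡n (count T * j) leaving ⟩
    leaving                             ∎
    where
    open ≤-Reasoning
    inside leaving : ℕ
    inside = ∑[ v < n ] (𝟙 (F v) * degreeIn b T v)
    leaving = ∑[ v < n ] (𝟙 (not (F v)) * degreeIn b T v)
    split : ∀ v → 𝟙 true * degreeIn b T v ≡ 𝟙 (F v) * degreeIn b T v + 𝟙 (not (F v)) * degreeIn b T v
    split v with F v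
    ... | true  = sym (+-identityʳ _)
    ... | false = refl
    total : count T * D ≤ count T * j + leaving
    total = begin
      count T * D                             ≤⟨ count*D≤degree-sum T T-deg ⟩
      ∑[ t < n ] (𝟙 (T t) * degree b t)       ≡⟨ double-count (neighbour b) (neighbour-sym c-sym b) (λ _ → true) T ⟨
      ∑[ v < n ] (𝟙 true * degreeIn b T v)   ≡⟨ sum-cong-≗ split ⟩
      ∑[ v < n ] (𝟙 (F v) * degreeIn b T v + 𝟙 (not (F v)) * degreeIn b T v)
        ≡⟨ ∑-distrib-+ (λ v → 𝟙 (F v) * degreeIn b T v) (λ v → 𝟙 (not (F v)) * degreeIn b T v) ⟩
      inside + leaving                        ≤⟨ +-monoˡ-≤ leaving (degreeIn-sum≤ b T F) ⟩
      count T * count F + leaving             ≤⟨ +-monoˡ-≤ leaving (*-monoʳ-≤ (count T) |F|≤j) ⟩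
      count T * j + leaving                   ∎

  greedy-step : ∀ (T F : Fin n → Bool) j → MinDegree T → count F ≤ j → j < n → E + j ≤ D →
    ∃ λ v → F v ≡ false × count T ≤ W * degreeIn b T v
  greedy-step T F j T-deg |F|≤j j<n E+j≤D with count<size⇒∃false F (≤-<-trans |F|≤j j<n)
  ... | v₀ , Fv₀ with averaging (λ v → not (F v)) (degreeIn b T) v₀ (cong not Fv₀)
  ...   | v , ¬Fv , avg = v , not-injective ¬Fv ,
    cancel-scale {W = W} n {{n≢0}} (≤-trans (edges-leaving-F T F j T-deg |F|≤j) avg) n≤W*E E≤D∸j
    where
    n≢0 : NonZero n
    n≢0 = >-nonZero (≤-<-trans z≤n j<n)
    E≤D∸j : E ≤ D ∸ j
    E≤D∸j = ≤-trans (≤-reflexive (sym (m+n∸n≡m E j))) (∸-monoˡ-≤ j E+j≤D)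
    not-injective : ∀ {x} → not x ≡ true → x ≡ false
    not-injective {false} _ = refl

  greedy-biclique : ∀ s (T F : Fin n → Bool) j → MinDegree T → count F ≤ j → j + s < n → E + (j + s) ≤ D →
    Biclique b W s T F
  greedy-biclique zero    T F j _ _ _ _ = empty-biclique T F
  greedy-biclique (suc s) T F j T-deg |F|≤j j+s<n E+j+s≤D = extend (greedy-step T F j T-deg |F|≤j j<n E+j≤D)
    where
    j<n : j < n
    j<n = ≤-<-trans (m≤m+n j (suc s)) j+s<n
    E+j≤D : E + j ≤ D
    E+j≤D = ≤-trans (+-monoʳ-≤ E (m≤m+n j (suc s))) E+j+s≤D
    extend : (∃ λ v → F v ≡ false × count T ≤ W * degreeIn b T v) → Biclique b W (suc s) T F
    extend (v , Fv , large) = biclique-extend v Fv large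
      (greedy-biclique s (λ t → T t ∧ neighbour b v t) (insert v F) (suc j)
        (λ t Tt → T-deg t (∧-trueˡ Tt))
        (≤-trans (≤-reflexive (count-insert v F Fv)) (s≤s |F|≤j))
        (subst (_< n) (+-suc j s) j+s<n)
        (subst (λ x → E + x ≤ D) (+-suc j s) E+j+s≤D))

module Rich {n} {c : Colouring n} (c-sym : Symmetric c) (D : ℕ) where

  open Neighbourhood c

  rich : Bool → Fin n → Bool
  rich b v = D ≤ᵇ degree b v

  mixed : Fin n → Bool
  mixed v = rich true v ∧ rich false v

  rich⇒D≤degree : ∀ {b v} → rich b v ≡ true → D ≤ degree b v
  rich⇒D≤degree {b} {v} rbv = ≤ᵇ⇒≤ D (degree b v) (Equivalence.from T-≡ rbv)

  poor⇒degree<D : ∀ {b v} → rich b v ≡ false → degree b v < D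
  poor⇒degree<D {b} {v} rbv = ≰⇒> (λ D≤deg → subst T rbv (≤⇒≤ᵇ D≤deg))

  degree-sum≤ : ∀ b → ∑[ v < n ] degree b v ≤ n * D + n * count (rich b)
  degree-sum≤ b =
    ≤-trans (sum-mono-≤ pointwise)
            (≤-reflexive (trans (∑-distrib-+ (λ _ → D) (λ v → n * 𝟙 (rich b v)))
                                (cong₂ _+_ (sum-const n D) (sym (*-distribˡ-sum n (λ v → 𝟙 (rich b v)))))))
    where
    pointwise : ∀ v → degree b v ≤ D + n * 𝟙 (rich b v)
    pointwise v with rich b v in rbv
    ... | false = ≤-trans (<⇒≤ (poor⇒degree<D rbv)) (m≤m+n D _)
    ... | true  = ≤-trans (count≤size (neighbour b v)) (≤-trans (≤-reflexive (sym (*-identityʳ n))) (m≤n+m _ D))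

  red-poor blue-poor-red-rich : Fin n → Bool
  red-poor v = not (rich true v)
  blue-poor-red-rich v = rich true v ∧ not (rich false v)

  red-poor-or-blue-poor-few : count red-poor ≤ D + D ⊎ count blue-poor-red-rich ≤ D + D
  red-poor-or-blue-poor-few =
    [y∸D]*x≤D*y⇒x≤2D⊎y≤2D (count X) (count Y) D (begin
      (count Y ∸ D) * count X                         ≡⟨ *-distribˡ-sum (count Y ∸ D) (λ u → 𝟙 (X u)) ⟩
      ∑[ u < n ] ((count Y ∸ D) * 𝟙 (X u))            ≤⟨ sum-mono-≤ from-X ⟩
      ∑[ u < n ] (𝟙 (X u) * degreeIn false Y u)       ≡⟨ double-count (neighbour false) (neighbour-sym c-sym false) X Y ⟩
      ∑[ v < n ] (𝟙 (Y v) * degreeIn false X v)       ≤⟨ sum-mono-≤ from-Y ⟩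
      ∑[ v < n ] (D * 𝟙 (Y v))                        ≡⟨ *-distribˡ-sum D (λ v → 𝟙 (Y v)) ⟨
      D * count Y                                     ∎)
    where
    open ≤-Reasoning
    X Y : Fin n → Bool
    X = red-poor
    Y = blue-poor-red-rich
    from-X : ∀ u → (count Y ∸ D) * 𝟙 (X u) ≤ 𝟙 (X u) * degreeIn false Y u
    from-X u with rich true u in ru
    ... | true  = ≤-reflexive (*-zeroʳ (count Y ∸ D))
    ... | false = begin
      (count Y ∸ D) * 1                       ≡⟨ *-identityʳ _ ⟩
      count Y ∸ D                             ≤⟨ ∸-monoˡ-≤ D (count≤degreeIn+degree Y u Yu) ⟩
      degreeIn false Y u + degree true u ∸ D
        ≤⟨ ∸-monoˡ-≤ D (+-monoʳ-≤ (degreeIn false Y u) (<⇒≤ (poor⇒degree<D ru))) ⟩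
      degreeIn false Y u + D ∸ D              ≡⟨ m+n∸n≡m (degreeIn false Y u) D ⟩
      degreeIn false Y u                      ≡⟨ +-identityʳ _ ⟨
      1 * degreeIn false Y u                  ∎
      where
      Yu : Y u ≡ false
      Yu rewrite ru = refl
    from-Y : ∀ v → 𝟙 (Y v) * degreeIn false X v ≤ D * 𝟙 (Y v)
    from-Y v with rich true v | rich false v in rv
    ... | false | _     = z≤n
    ... | true  | true  = z≤n
    ... | true  | false = begin
      1 * degreeIn false X v  ≡⟨ +-identityʳ _ ⟩
      degreeIn false X v      ≤⟨ count-mono (λ t → ∧-trueʳ {X t}) ⟩
      degree false v          ≤⟨ <⇒≤ (poor⇒degree<D rv) ⟩
      D                       ≡⟨ *-identityʳ D ⟨
      D * 1                   ∎

  some-colour-few-rich : ∃ λ b → count (rich b) ≤ D + D + count mixed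
  some-colour-few-rich with red-poor-or-blue-poor-few
  ... | inj₁ few-red-poor = false , ≤-trans (count-cover blue-rich-cover) (+-monoˡ-≤ (count mixed) few-red-poor)
    where
    blue-rich-cover : rich false ⊆ᵇ (λ v → red-poor v ∨ mixed v)
    blue-rich-cover v rfv with rich true v
    ... | true  = rfv
    ... | false = refl
  ... | inj₂ few-blue-poor = true , ≤-trans (count-cover red-rich-cover) (+-monoˡ-≤ (count mixed) few-blue-poor)
    where
    red-rich-cover : rich true ⊆ᵇ (λ v → blue-poor-red-rich v ∨ mixed v)
    red-rich-cover v rtv rewrite rtv with rich false v
    ... | true  = refl
    ... | false = refl

  many-mixed : ∀ Q .{{_ : NonZero n}} → (∀ b → n * (n ∸ 1) ≤ Q * ∑[ v < n ] degree b v) →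
    n ∸ 1 ≤ Q * (D + D + D + count mixed)
  many-mixed Q balanced with some-colour-few-rich
  ... | b , few = *-cancelˡ-≤ n (begin
    n * (n ∸ 1)                                  ≤⟨ balanced b ⟩
    Q * ∑[ v < n ] degree b v                    ≤⟨ *-monoʳ-≤ Q (degree-sum≤ b) ⟩
    Q * (n * D + n * count (rich b))             ≤⟨ *-monoʳ-≤ Q (+-monoʳ-≤ (n * D) (*-monoʳ-≤ n few)) ⟩
    Q * (n * D + n * (D + D + count mixed))      ≡⟨ ring Q n D (count mixed) ⟩
    n * (Q * (D + D + D + count mixed))          ∎)
    where
    open ≤-Reasoning
    ring : ∀ Q n D M → Q * (n * D + n * (D + D + M)) ≡ n * (Q * (D + D + D + M))
    ring = solve-∀

SharedBicliques : ∀ {n} → Colouring n → ℕ → ℕ → Set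
SharedBicliques c ℓ k = ∃[ A ] ∃[ B ] ∃[ S ]
  (Disjoint A B × Disjoint A S × Disjoint B S ×
   ∣ A ∣ ≡ ℓ × ∣ B ∣ ≡ ℓ × ∣ S ∣ ≡ k ×
   AllColoured c true A S × AllColoured c false B S)

∣tabulate∣≡count : ∀ {m} (P : Fin m → Bool) → ∣ Vec.tabulate P ∣ ≡ count P
∣tabulate∣≡count {zero}  P = refl
∣tabulate∣≡count {suc m} P with P zero
... | true  = cong suc (∣tabulate∣≡count (λ i → P (suc i)))
... | false = ∣tabulate∣≡count (λ i → P (suc i))

∈-tabulate⁻ : ∀ {m} (P : Fin m → Bool) i → i ∈ Vec.tabulate P → P i ≡ true
∈-tabulate⁻ P i i∈P = trans (sym (lookup∘tabulate P i)) ([]=⇒lookup i∈P)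

module _ {n} {c : Colouring n} where

  open Neighbourhood c
  open Biclique

  nested-bicliques-large : ∀ {W ℓ M} (red : Biclique true W ℓ M (λ _ → false)) →
    (blue : Biclique false W ℓ (leaves red) (centres red)) → count M ≤ W ^ (ℓ + ℓ) * count (leaves blue)
  nested-bicliques-large {W} {ℓ} {M} red blue = begin
    count M                                     ≤⟨ leaves-large red ⟩
    W ^ ℓ * count (leaves red)                  ≤⟨ *-monoʳ-≤ (W ^ ℓ) (leaves-large blue) ⟩
    W ^ ℓ * (W ^ ℓ * count (leaves blue))       ≡⟨ *-assoc (W ^ ℓ) (W ^ ℓ) _ ⟨
    W ^ ℓ * W ^ ℓ * count (leaves blue)         ≡⟨ cong (_* count (leaves blue)) (^-distribˡ-+-* W ℓ ℓ) ⟨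
    W ^ (ℓ + ℓ) * count (leaves blue)           ∎
    where
    open ≤-Reasoning

  bicliques⇒shared-bicliques : ∀ {W ℓ k M} (red : Biclique true W ℓ M (λ _ → false)) →
    (blue : Biclique false W ℓ (leaves red) (centres red)) → k ≤ count (leaves blue) → SharedBicliques c ℓ k
  bicliques⇒shared-bicliques {k = k} red blue k≤|TB| with subset-of-size (leaves blue) k k≤|TB|
  ... | S , S⊆TB , |S| =
    Vec.tabulate A , Vec.tabulate B , Vec.tabulate S ,
    (λ i a b → A∩B i (∈-tabulate⁻ A i a) (∈-tabulate⁻ B i b)) ,
    (λ i a s → A∩S i (∈-tabulate⁻ A i a) (∈-tabulate⁻ S i s)) ,
    (λ i b s → B∩S i (∈-tabulate⁻ B i b) (∈-tabulate⁻ S i s)) ,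
    trans (∣tabulate∣≡count A) (count-centres red) ,
    trans (∣tabulate∣≡count B) (count-centres blue) ,
    trans (∣tabulate∣≡count S) |S| ,
    (λ i j a s → neighbour⇒colour true i j (A→S i j (∈-tabulate⁻ A i a) (∈-tabulate⁻ S j s))) ,
    (λ i j b s → neighbour⇒colour false i j (B→S i j (∈-tabulate⁻ B i b) (∈-tabulate⁻ S j s)))
    where
    A B : Fin n → Bool
    A = centres red
    B = centres blue
    A→S : ∀ i j → A i ≡ true → S j ≡ true → neighbour true i j ≡ true
    A→S i j a s = complete red i j a (leaves⊆T blue j (S⊆TB j s))
    B→S : ∀ i j → B i ≡ true → S j ≡ true → neighbour false i j ≡ true
    B→S i j b s = complete blue i j b (S⊆TB j s)
    A∩B : ∀ i → A i ≡ true → B i ≡ true → ⊥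
    A∩B i a b with () ← trans (sym a) (centres-avoid-F blue i b)
    A∩S : ∀ i → A i ≡ true → S i ≡ true → ⊥
    A∩S i a s with () ← trans (sym (A→S i i a s)) (neighbour-irrefl true i)
    B∩S : ∀ i → B i ≡ true → S i ≡ true → ⊥
    B∩S i b s with () ← trans (sym (B→S i i b s)) (neighbour-irrefl false i)

balanced⇒shared-bicliques : ∀ {n} (c : Colouring n) → Symmetric c → ∀ q ℓ k → 1 ≤ q → 1 ≤ ℓ →
  96 * q * ℓ < n → (32 * q) ^ suc (ℓ + ℓ) * k < n → (∀ b → n C 2 ≤ q * edgeCount c b) →
  SharedBicliques c ℓ k
balanced⇒shared-bicliques {zero}  c c-sym q ℓ k 1≤q 1≤ℓ ()
balanced⇒shared-bicliques {suc m} c c-sym q ℓ k 1≤q 1≤ℓ 96qℓ<n W^[1+2ℓ]k<n balanced =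
  bicliques⇒shared-bicliques red blue (<⇒≤ k<|TB|)
  where
  open Neighbourhood c
  open Biclique
  n W : ℕ
  n = suc m
  W = 32 * q
  instance
    16q≢0 : NonZero (16 * q)
    16q≢0 = m*n≢0 16 q {{_}} {{>-nonZero 1≤q}}
  D E : ℕ
  D = m / (16 * q)
  open Rich c-sym D
  E = D ∸ (ℓ + ℓ)
  gap : ℓ + ℓ ≤ D × n ≤ W * E
  gap = threshold-gap n q ℓ D 1≤ℓ (1+m≤d*[1+m/d] m (16 * q)) 96qℓ<n
  2ℓ≤D : ℓ + ℓ ≤ D
  2ℓ≤D = proj₁ gap
  n≤W*E : n ≤ W * E
  n≤W*E = proj₂ gap
  ℓ+ℓ≤m : ℓ + ℓ ≤ m
  ℓ+ℓ≤m = ≤-trans 2ℓ≤D (m/n≤m m (16 * q))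
  ℓ+ℓ<n : ℓ + ℓ < n
  ℓ+ℓ<n = s≤s ℓ+ℓ≤m
  n≤W*M : n ≤ W * count mixed
  n≤W*M = 1+m≤32qM m q D (count mixed) (d*[m/d]≤m m (16 * q))
            (many-mixed (2 * q) (λ b → balanced⇒degree-sum q b (balanced b)))
            (≤-trans 1≤ℓ (≤-trans (m≤m+n ℓ ℓ) ℓ+ℓ≤m))
  red : Biclique true W ℓ mixed (λ _ → false)
  red = Greedy.greedy-biclique c-sym true n≤W*E ℓ mixed (λ _ → false) 0
          (λ t Mt → rich⇒D≤degree (∧-trueˡ Mt)) (≤-reflexive (count-empty {n}))
          (≤-<-trans (m≤n+m ℓ ℓ) ℓ+ℓ<n) (≤-trans (+-monoʳ-≤ E (m≤n+m ℓ ℓ)) (≤-reflexive (m∸n+n≡m 2ℓ≤D)))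
  blue : Biclique false W ℓ (leaves red) (centres red)
  blue = Greedy.greedy-biclique c-sym false n≤W*E ℓ (leaves red) (centres red) ℓ
           (λ t Tt → rich⇒D≤degree (∧-trueʳ {rich true t} (leaves⊆T red t Tt))) (≤-reflexive (count-centres red))
           ℓ+ℓ<n (≤-reflexive (m∸n+n≡m 2ℓ≤D))
  n≤W^[1+2ℓ]*|TB| : n ≤ W ^ suc (ℓ + ℓ) * count (leaves blue)
  n≤W^[1+2ℓ]*|TB| = ≤-trans n≤W*M (≤-trans (*-monoʳ-≤ W (nested-bicliques-large red blue))
                                            (≤-reflexive (sym (*-assoc W (W ^ (ℓ + ℓ)) _))))
  k<|TB| : k < count (leaves blue)
  k<|TB| = *-cancelˡ-< (W ^ suc (ℓ + ℓ)) k _ (<-≤-trans W^[1+2ℓ]k<n n≤W^[1+2ℓ]*|TB|)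

corollary3 : (ε : ℚ) → 0ℚ <ℚ ε →
    ∃[ Cε ] ((ℓ k : ℕ) → ℓ ≥ 1 → k ≥ 1 →
      ∃[ N ] (N ≤ℕ Cε * k * (4 * ℓ) ^ (2 * ℓ) ×
        ((n : ℕ) → N < n → (c : Colouring n) → Symmetric c → Balanced ε c →
          ∃[ A ] ∃[ B ] ∃[ S ]
            (Disjoint A B × Disjoint A S × Disjoint B S ×
             ∣ A ∣ ≡ ℓ × ∣ B ∣ ≡ ℓ × ∣ S ∣ ≡ k ×
             AllColoured c true A S × AllColoured c false B S))))
corollary3 ε ε>0 with positive-scale-bound ε ε>0
... | q , 1≤q , scale = 96 * q * (32 * q) ^ (16 * q) , λ ℓ k ℓ≥1 k≥1 →
  let 96qℓ≤N , W^[1+2ℓ]k≤N = size-bounds q ℓ k 1≤q ℓ≥1 k≥1 in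
  _ , ≤-refl , λ n N<n c c-sym (red-balanced , blue-balanced) →
    balanced⇒shared-bicliques c c-sym q ℓ k 1≤q ℓ≥1 (≤-<-trans 96qℓ≤N N<n) (≤-<-trans W^[1+2ℓ]k≤N N<n)
      λ { true → scale _ _ red-balanced ; false → scale _ _ blue-balanced }
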